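{- Let $n\ge2$, ${\cal I}=\{(i,j)\mid 1\le i\le n,\ 1\le j\le n+1\}$ and $S=\{(i,j)\in{\cal I}\mid i+j\le n+1\}$. Let $X\ne Y$ be tables in the same fiber and $Z=(z_{ij})=X-Y$. Suppose there are rows $i_a<i_b<i_c$ with either (i) $z_{i_a1}>0$, $z_{i_b1}<0$, $z_{i_c1}>0$, or (ii) $z_{i_a1}<0$, $z_{i_b1}>0$, $z_{i_c1}<0$. Then $\Vert X-Y\Vert_1$ can be reduced by ${\cal B}_0(S)$.
   Context: A table is an array on ${\cal I}$ with entries in $\mathbb{N}=\{0,1,\dots\}$; the fiber of $X$ is the set of tables with the same row sums, column sums and sum of entries over $S$. For $i\ne i'$, $j\ne j'$, the basic move $B(i,i';j,j')$ has $+1$ at $(i,j),(i',j')$, $-1$ at $(i,j'),(i',j)$, $0$ elsewhere; ${\cal B}_0(S)$ is the set of basic moves whose entries over $S$ sum to $0$. $\Vert W\Vert_1=\sum|w_{ij}|$. For $X\ne Y$ in the same fiber ${\cal F}$, $\Vert X-Y\Vert_1$ can be reduced by ${\cal B}_0(S)$ if there exist $\tau^+,\tau^-\ge0$, $\tau^++\tau^->0$, and $B^+_1,\dots,B^+_{\tau^+},B^-_1,\dots,B^-_{\tau^- }\in{\cal B}_0(S)$ with $X+\sum_{t=1}^{\tau'}B^+_t\in{\cal F}$ ($\tau'=1,\dots,\tau^+$), $Y-\sum_{t=1}^{\tau'}B^-_t\in{\cal F}$ ($\tau'=1,\dots,\tau^-$), and $\Vert X-Y+\sum_t B^+_t+\sum_t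 B^-_t\Vert_1<\Vert X-Y\Vert_1$. -}

module Defs where

open import Data.Nat using (ℕ; zero; suc; _<_; _≤_) renaming (_+_ to _+ℕ_)
open import Data.Integer using (ℤ; +_; ∣_∣) renaming (_+_ to _+ℤ_; _-_ to _-ℤ_)
open import Data.Fin using (Fin; toℕ; _≟_)
import Data.Fin
import Data.Nat
import Data.Integer
open import Data.List using (List; []; _∷_; take; length)
open import Data.Product using (Σ; _×_; _,_)
open import Relation.Nullary using (¬_; yes; no)
open import Relation.Binary.PropositionalEquality using (_≡_)

-- Conventions: n rows and n+1 columns; row index r : Fin n stands for i = toℕ r + 1,
-- column index c : Fin (suc n) stands for j = toℕ c + 1.

∑ : ∀ {k} → (Fin k → ℕ) → ℕ
∑ {zero}  f = 0
∑ {suc k} f = f Data.Fin.zero +ℕ ∑ (λ i → f (Data.Fin.suc i))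

∑ℤ : ∀ {k} → (Fin k → ℤ) → ℤ
∑ℤ {zero}  f = + 0
∑ℤ {suc k} f = f Data.Fin.zero +ℤ ∑ℤ (λ i → f (Data.Fin.suc i))

Table : ℕ → Set
Table n = Fin n → Fin (suc n) → ℕ

Array : ℕ → Set
Array n = Fin n → Fin (suc n) → ℤ

-- S = {(i,j) | i + j ≤ n + 1}; with i = toℕ r + 1, j = toℕ c + 1 this is
-- toℕ r + toℕ c + 2 ≤ n + 1.
-- indicator of S
χS : ∀ {n} → Fin n → Fin (suc n) → ℕ
χS {n} r c with suc (suc (toℕ r +ℕ toℕ c)) Data.Nat.≤? suc n
... | yes _ = 1
... | no  _ = 0

χSℤ : ∀ {n} → Fin n → Fin (suc n) → ℤ
χSℤ r c = + χS r c

rowSum : ∀ {n} → Table n → Fin n → ℕ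
rowSum X r = ∑ (λ c → X r c)

colSum : ∀ {n} → Table n → Fin (suc n) → ℕ
colSum X c = ∑ (λ r → X r c)

sumS : ∀ {n} → Table n → ℕ
sumS X = ∑ (λ r → ∑ (λ c → χS r c Data.Nat.* X r c))

sumSℤ : ∀ {n} → Array n → ℤ
sumSℤ W = ∑ℤ (λ r → ∑ℤ (λ c → χSℤ r c Data.Integer.* W r c))

SameFiber : ∀ {n} → Table n → Table n → Set
SameFiber X Y = (∀ r → rowSum X r ≡ rowSum Y r)
              × (∀ c → colSum X c ≡ colSum Y c)
              × (sumS X ≡ sumS Y)

toArray : ∀ {n} → Table n → Array n
toArray X r c = + X r c

_⊕_ : ∀ {n} → Array n → Array n → Array n
(V ⊕ W) r c = V r c +ℤ W r c

_⊖_ : ∀ {n} → Array n → Array n → Array n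
(V ⊖ W) r c = V r c -ℤ W r c

zeroArray : ∀ {n} → Array n
zeroArray r c = + 0

InFiberOf : ∀ {n} → Table n → Array n → Set
InFiberOf {n} X W = Σ (Table n) (λ T → (∀ r c → toArray T r c ≡ W r c) × SameFiber T X)

δ : ∀ {k} → Fin k → Fin k → ℤ
δ a b with a ≟ b
... | yes _ = + 1
... | no  _ = + 0

basicArray : ∀ {n} → Fin n → Fin n → Fin (suc n) → Fin (suc n) → Array n
basicArray i i' j j' r c =
  ((δ i r Data.Integer.* δ j c) +ℤ (δ i' r Data.Integer.* δ j' c))
  -ℤ ((δ i r Data.Integer.* δ j' c) +ℤ (δ i' r Data.Integer.* δ j c))

record B₀S (n : ℕ) : Set where
  field
    i i' : Fin n
    j j' : Fin (suc n)
    i≢i' : ¬ (i ≡ i')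
    j≢j' : ¬ (j ≡ j')
    sumS≡0 : sumSℤ (basicArray i i' j j') ≡ + 0

move : ∀ {n} → B₀S n → Array n
move B = basicArray (B₀S.i B) (B₀S.i' B) (B₀S.j B) (B₀S.j' B)

sumMoves : ∀ {n} → List (B₀S n) → Array n
sumMoves []       = zeroArray
sumMoves (B ∷ Bs) = move B ⊕ sumMoves Bs

norm1 : ∀ {n} → Array n → ℕ
norm1 W = ∑ (λ r → ∑ (λ c → ∣ W r c ∣))

Reducible : ∀ {n} → Table n → Table n → Set
Reducible {n} X Y =
  Σ (List (B₀S n)) λ Bp → Σ (List (B₀S n)) λ Bm →
    (0 < length Bp +ℕ length Bm)
  × (∀ k → 1 ≤ k → k ≤ length Bp → InFiberOf X (toArray X ⊕ sumMoves (take k Bp)))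
  × (∀ k → 1 ≤ k → k ≤ length Bm → InFiberOf X (toArray Y ⊖ sumMoves (take k Bm)))
  × (norm1 (((toArray X ⊖ toArray Y) ⊕ sumMoves Bp) ⊕ sumMoves Bm)
       < norm1 (toArray X ⊖ toArray Y))

-- In case (i) row ib has a deficit in column 1, and since X and Y have
-- the same row sums some column j > 1 has X > Y in row ib. Column 1 lies in S for every
-- row and S is a down-set in the row order, so one of the rows k ∈ {ia, ic} has (k, j) ∈ S
-- exactly when (ib, j) ∈ S; the basic move B(ib, k; 1, j) then has S-sum 0. Adding it to X
-- keeps a table (X is positive at the two cells it decrements), and it moves three entries
-- of Z one step towards 0 while the fourth changes by at most 1, so ‖Z‖₁ drops by 2.
-- Case (ii) is case (i) for (Y, X), realised by subtracting the opposite move from Y.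

module Submission where

open import Defs
open import Data.Nat using (ℕ; suc; _≤_)
open import Data.Integer using (+_) renaming (_<_ to _<ℤ_)
open import Data.Fin using (Fin; zero; _<_)
open import Data.Product using (_×_)
open import Data.Sum using (_⊎_)
open import Relation.Nullary using (¬_)
open import Relation.Binary.PropositionalEquality using (_≡_)

import Data.Nat as ℕ
open import Data.Nat using (z≤n; s≤s)
import Data.Nat.Properties as ℕₚ
open import Data.Integer using (ℤ; 0ℤ; 1ℤ; -[1+_]; _+_; _*_; _-_; -_; ∣_∣; +≤+; +<+)
  renaming (_≤_ to _≤ℤ_)
import Data.Integer.Properties as ℤₚ
open import Data.Integer.Tactic.RingSolver using (solve-∀)
open import Algebra.Properties.CommutativeSemigroup ℤₚ.+-commutativeSemigroup using (interchange)
open import Algebra.Properties.AbelianGroup ℤₚ.+-0-abelianGroup using (⁻¹-anti-homo‿-)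
import Data.Fin as Fin
open import Data.Fin using (toℕ)
import Data.Fin.Properties as Finₚ
open import Data.Product using (Σ-syntax; _,_; proj₁)
open import Data.Sum using (inj₁; inj₂)
open import Data.List using ([]; _∷_; take)
open import Function using (_∘_)
open import Relation.Nullary using (yes; no; contradiction)
open import Relation.Binary.PropositionalEquality
  using (_≢_; refl; sym; trans; cong; cong₂; subst; subst₂; module ≡-Reasoning)

∑-cong : ∀ {k} {f g : Fin k → ℕ} → (∀ i → f i ≡ g i) → ∑ f ≡ ∑ g
∑-cong {ℕ.zero} f≗g = refl
∑-cong {suc k}  f≗g = cong₂ ℕ._+_ (f≗g zero) (∑-cong (f≗g ∘ Fin.suc))

∑-toℤ : ∀ {k} (f : Fin k → ℕ) → + ∑ f ≡ ∑ℤ (λ i → + f i)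
∑-toℤ {ℕ.zero} f = refl
∑-toℤ {suc k}  f = cong (_+_ (+ f zero)) (∑-toℤ (f ∘ Fin.suc))

∑ℤ-cong : ∀ {k} {f g : Fin k → ℤ} → (∀ i → f i ≡ g i) → ∑ℤ f ≡ ∑ℤ g
∑ℤ-cong {ℕ.zero} f≗g = refl
∑ℤ-cong {suc k}  f≗g = cong₂ _+_ (f≗g zero) (∑ℤ-cong (f≗g ∘ Fin.suc))

∑ℤ-distrib-+ : ∀ {k} (f g : Fin k → ℤ) → ∑ℤ (λ i → f i + g i) ≡ ∑ℤ f + ∑ℤ g
∑ℤ-distrib-+ {ℕ.zero} f g = refl
∑ℤ-distrib-+ {suc k}  f g =
  trans (cong (_+_ (f zero + g zero)) (∑ℤ-distrib-+ (f ∘ Fin.suc) (g ∘ Fin.suc)))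
        (interchange (f zero) (g zero) _ _)

∑ℤ-neg : ∀ {k} (f : Fin k → ℤ) → ∑ℤ (λ i → - f i) ≡ - ∑ℤ f
∑ℤ-neg {ℕ.zero} f = refl
∑ℤ-neg {suc k}  f =
  trans (cong (_+_ (- f zero)) (∑ℤ-neg (f ∘ Fin.suc))) (sym (ℤₚ.neg-distrib-+ (f zero) _))

∑ℤ-*ˡ : ∀ {k} a (f : Fin k → ℤ) → ∑ℤ (λ i → a * f i) ≡ a * ∑ℤ f
∑ℤ-*ˡ {ℕ.zero} a f = sym (ℤₚ.*-zeroʳ a)
∑ℤ-*ˡ {suc k}  a f =
  trans (cong (_+_ (a * f zero)) (∑ℤ-*ˡ a (f ∘ Fin.suc))) (sym (ℤₚ.*-distribˡ-+ a (f zero) _))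

∑ℤ-mono-≤ : ∀ {k} {f g : Fin k → ℤ} → (∀ i → f i ≤ℤ g i) → ∑ℤ f ≤ℤ ∑ℤ g
∑ℤ-mono-≤ {ℕ.zero} f≤g = ℤₚ.≤-refl
∑ℤ-mono-≤ {suc k}  f≤g = ℤₚ.+-mono-≤ (f≤g zero) (∑ℤ-mono-≤ (f≤g ∘ Fin.suc))

δ-suc : ∀ {k} (a b : Fin k) → δ (Fin.suc a) (Fin.suc b) ≡ δ a b
δ-suc a b with a Finₚ.≟ b
... | yes refl = refl
... | no _     = refl

-- δ zero (suc i) computes to 0ℤ, and 0ℤ * x computes to 0ℤ: the tail of the sum in the
-- first clause is literally ∑ℤ (λ i → 0ℤ * f (suc i)).
∑ℤ-δ : ∀ {k} (p : Fin k) (f : Fin k → ℤ) → ∑ℤ (λ i → δ p i * f i) ≡ f p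
∑ℤ-δ zero f =
  trans (cong₂ _+_ (ℤₚ.*-identityˡ (f zero)) (∑ℤ-*ˡ 0ℤ (f ∘ Fin.suc))) (ℤₚ.+-identityʳ (f zero))
∑ℤ-δ (Fin.suc p) f =
  trans (ℤₚ.+-identityˡ _)
        (trans (∑ℤ-cong (λ i → cong (_* f (Fin.suc i)) (δ-suc p i))) (∑ℤ-δ p (f ∘ Fin.suc)))

∑<∑⇒∃< : ∀ {k} (f g : Fin k → ℕ) → ∑ f ℕ.< ∑ g → Σ[ c ∈ Fin k ] f c ℕ.< g c
∑<∑⇒∃< {ℕ.zero} f g ()
∑<∑⇒∃< {suc k}  f g ∑f<∑g with f zero ℕ.<? g zero
... | yes f₀<g₀ = zero , f₀<g₀
... | no  f₀≮g₀ =
  let c , fc<gc = ∑<∑⇒∃< (f ∘ Fin.suc) (g ∘ Fin.suc) (ℕₚ.≰⇒> λ ∑g′≤∑f′ →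
                    ℕₚ.<⇒≱ ∑f<∑g (ℕₚ.+-mono-≤ (ℕₚ.≮⇒≥ f₀≮g₀) ∑g′≤∑f′))
  in Fin.suc c , fc<gc

∑≡∑⇒∃> : ∀ {k} (f g : Fin (suc k) → ℕ) → ∑ f ≡ ∑ g → f zero ℕ.< g zero →
         Σ[ c ∈ Fin k ] g (Fin.suc c) ℕ.< f (Fin.suc c)
∑≡∑⇒∃> f g ∑f≡∑g f₀<g₀ = ∑<∑⇒∃< (g ∘ Fin.suc) (f ∘ Fin.suc) (ℕₚ.≰⇒> λ ∑f′≤∑g′ →
  ℕₚ.<-irrefl ∑f≡∑g (ℕₚ.+-mono-<-≤ f₀<g₀ ∑f′≤∑g′))

∑∑ : ∀ {n} → Array n → ℤ
∑∑ W = ∑ℤ (λ r → ∑ℤ (W r))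

∑∑-cong : ∀ {n} {V W : Array n} → (∀ r c → V r c ≡ W r c) → ∑∑ V ≡ ∑∑ W
∑∑-cong V≗W = ∑ℤ-cong (λ r → ∑ℤ-cong (V≗W r))

∑∑-distrib-+ : ∀ {n} (V W : Array n) → ∑∑ (V ⊕ W) ≡ ∑∑ V + ∑∑ W
∑∑-distrib-+ V W =
  trans (∑ℤ-cong (λ r → ∑ℤ-distrib-+ (V r) (W r))) (∑ℤ-distrib-+ (∑ℤ ∘ V) (∑ℤ ∘ W))

∑∑-neg : ∀ {n} (W : Array n) → ∑∑ (λ r c → - W r c) ≡ - ∑∑ W
∑∑-neg W = trans (∑ℤ-cong (λ r → ∑ℤ-neg (W r))) (∑ℤ-neg (∑ℤ ∘ W))

∑∑-mono-≤ : ∀ {n} {V W : Array n} → (∀ r c → V r c ≤ℤ W r c) → ∑∑ V ≤ℤ ∑∑ W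
∑∑-mono-≤ V≤W = ∑ℤ-mono-≤ (λ r → ∑ℤ-mono-≤ (V≤W r))

-- Row sums, column sums and the S-sum are all pairings inner w with a fixed weight w.
inner : ∀ {n} → Array n → Array n → ℤ
inner w W = ∑∑ (λ r c → w r c * W r c)

inner-cong : ∀ {n} (w : Array n) {V W : Array n} → (∀ r c → V r c ≡ W r c) → inner w V ≡ inner w W
inner-cong w V≗W = ∑∑-cong (λ r c → cong (w r c *_) (V≗W r c))

inner-⊕ : ∀ {n} (w V W : Array n) → inner w (V ⊕ W) ≡ inner w V + inner w W
inner-⊕ w V W =
  trans (∑∑-cong (λ r c → ℤₚ.*-distribˡ-+ (w r c) (V r c) (W r c)))
        (∑∑-distrib-+ (λ r c → w r c * V r c) (λ r c → w r c * W r c))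

inner-⊖ : ∀ {n} (w V W : Array n) → inner w (V ⊖ W) ≡ inner w V - inner w W
inner-⊖ w V W =
  trans (inner-⊕ w V (λ r c → - W r c))
        (cong (_+_ (inner w V)) (trans (∑∑-cong (λ r c → sym (ℤₚ.neg-distribʳ-* (w r c) (W r c))))
                                    (∑∑-neg (λ r c → w r c * W r c))))

unit : ∀ {n} → Fin n → Fin (suc n) → Array n
unit p q r c = δ p r * δ q c

inner-unit : ∀ {n} (w : Array n) p q → inner w (unit p q) ≡ w p q
inner-unit w p q = begin
  ∑ℤ (λ r → ∑ℤ (λ c → w r c * (δ p r * δ q c)))
    ≡⟨ ∑ℤ-cong (λ r → trans (∑ℤ-cong (λ c → reorder (w r c) (δ p r) (δ q c)))
                            (∑ℤ-*ˡ (δ p r) (λ c → δ q c * w r c))) ⟩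
  ∑ℤ (λ r → δ p r * ∑ℤ (λ c → δ q c * w r c))
    ≡⟨ ∑ℤ-cong (λ r → cong (δ p r *_) (∑ℤ-δ q (w r))) ⟩
  ∑ℤ (λ r → δ p r * w r q)
    ≡⟨ ∑ℤ-δ p (λ r → w r q) ⟩
  w p q ∎
  where
  open ≡-Reasoning
  reorder : ∀ x a b → x * (a * b) ≡ a * (b * x)
  reorder = solve-∀

∑∑-unit : ∀ {n} (p : Fin n) q → ∑∑ (unit p q) ≡ 1ℤ
∑∑-unit p q =
  trans (∑∑-cong (λ r c → sym (ℤₚ.*-identityˡ (unit p q r c)))) (inner-unit (λ _ _ → 1ℤ) p q)

-- basicArray i i' j j' is, by definition, (unit i j ⊕ unit i' j') ⊖ (unit i j' ⊕ unit i' j).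
inner-basic : ∀ {n} (w : Array n) i i' j j' →
              inner w (basicArray i i' j j') ≡ (w i j + w i' j') - (w i j' + w i' j)
inner-basic w i i' j j' = begin
  inner w ((unit i j ⊕ unit i' j') ⊖ (unit i j' ⊕ unit i' j))
    ≡⟨ inner-⊖ w (unit i j ⊕ unit i' j') (unit i j' ⊕ unit i' j) ⟩
  inner w (unit i j ⊕ unit i' j') - inner w (unit i j' ⊕ unit i' j)
    ≡⟨ cong₂ _-_ (inner-⊕ w (unit i j) (unit i' j')) (inner-⊕ w (unit i j') (unit i' j)) ⟩
  (inner w (unit i j) + inner w (unit i' j')) - (inner w (unit i j') + inner w (unit i' j))
    ≡⟨ cong₂ _-_ (cong₂ _+_ (inner-unit w i j) (inner-unit w i' j'))
                 (cong₂ _+_ (inner-unit w i j') (inner-unit w i' j)) ⟩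
  (w i j + w i' j') - (w i j' + w i' j) ∎
  where open ≡-Reasoning

inner-basic≡0 : ∀ {n} (w : Array n) {i i' j j'} →
                w i j + w i' j' ≡ w i j' + w i' j → inner w (basicArray i i' j j') ≡ 0ℤ
inner-basic≡0 w {i} {i'} {j} {j'} balanced = trans (inner-basic w i i' j j') (ℤₚ.i≡j⇒i-j≡0 balanced)

inner-basic≡0⇒balanced : ∀ {n} (w : Array n) {i i' j j'} →
                         inner w (basicArray i i' j j') ≡ 0ℤ → w i j + w i' j' ≡ w i j' + w i' j
inner-basic≡0⇒balanced w {i} {i'} {j} {j'} h = ℤₚ.i-j≡0⇒i≡j _ _ (trans (sym (inner-basic w i i' j j')) h)

rowSum-inner : ∀ {n} (T : Table n) r → + rowSum T r ≡ inner (λ r′ _ → δ r r′) (toArray T)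
rowSum-inner T r = begin
  + rowSum T r                                ≡⟨ ∑-toℤ (T r) ⟩
  ∑ℤ (λ c → + T r c)                          ≡⟨ ∑ℤ-δ r (λ r′ → ∑ℤ (λ c → + T r′ c)) ⟨
  ∑ℤ (λ r′ → δ r r′ * ∑ℤ (λ c → + T r′ c))    ≡⟨ ∑ℤ-cong (λ r′ → ∑ℤ-*ˡ (δ r r′) (λ c → + T r′ c)) ⟨
  inner (λ r′ _ → δ r r′) (toArray T)         ∎
  where open ≡-Reasoning

colSum-inner : ∀ {n} (T : Table n) c → + colSum T c ≡ inner (λ _ c′ → δ c c′) (toArray T)
colSum-inner T c =
  trans (∑-toℤ (λ r → T r c)) (∑ℤ-cong (λ r → sym (∑ℤ-δ c (λ c′ → + T r c′))))

sumS-inner : ∀ {n} (T : Table n) → + sumS T ≡ inner χSℤ (toArray T)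
sumS-inner T = trans (∑-toℤ (λ r → ∑ (λ c → χS r c ℕ.* T r c))) (∑ℤ-cong (λ r →
  trans (∑-toℤ (λ c → χS r c ℕ.* T r c)) (∑ℤ-cong (λ c → ℤₚ.pos-* (χS r c) (T r c)))))

opposite : ∀ {n} → B₀S n → B₀S n
opposite B = record
  { i = i ; i' = i' ; j = j' ; j' = j ; i≢i' = i≢i' ; j≢j' = j≢j' ∘ sym
  ; sumS≡0 = inner-basic≡0 χSℤ {i} {i'} {j'} {j}
               (sym (inner-basic≡0⇒balanced χSℤ {i} {i'} {j} {j'} sumS≡0))
  }
  where open B₀S B

move-opposite : ∀ {n} (B : B₀S n) r c → move (opposite B) r c ≡ - move B r c
move-opposite B r c = sym (⁻¹-anti-homo‿- (unit i j r c + unit i' j' r c) (unit i j' r c + unit i' j r c))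
  where open B₀S B

move-fiber : ∀ {n} (U : Table n) (B : B₀S n) → (∀ r c → 0ℤ ≤ℤ + U r c + move B r c) →
             InFiberOf U (toArray U ⊕ move B)
move-fiber {n} U B U+B≥0 = T , T≡U+B , rows , cols , sumS-T
  where
  open B₀S B
  T : Table n
  T r c = ∣ + U r c + move B r c ∣
  T≡U+B : ∀ r c → + T r c ≡ + U r c + move B r c
  T≡U+B r c = ℤₚ.0≤i⇒+∣i∣≡i (U+B≥0 r c)
  inner-T : ∀ w → inner w (move B) ≡ 0ℤ → inner w (toArray T) ≡ inner w (toArray U)
  inner-T w wB≡0 = begin
    inner w (toArray T)                      ≡⟨ inner-cong w T≡U+B ⟩
    inner w (toArray U ⊕ move B)             ≡⟨ inner-⊕ w (toArray U) (move B) ⟩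
    inner w (toArray U) + inner w (move B)   ≡⟨ cong (_+_ (inner w (toArray U))) wB≡0 ⟩
    inner w (toArray U) + 0ℤ                 ≡⟨ ℤₚ.+-identityʳ _ ⟩
    inner w (toArray U)                      ∎
    where open ≡-Reasoning
  rows : ∀ r → rowSum T r ≡ rowSum U r
  rows r = ℤₚ.+-injective (trans (rowSum-inner T r)
    (trans (inner-T w (inner-basic≡0 w {i} {i'} {j} {j'} refl)) (sym (rowSum-inner U r))))
    where w = λ r′ _ → δ r r′
  cols : ∀ c → colSum T c ≡ colSum U c
  cols c = ℤₚ.+-injective (trans (colSum-inner T c)
    (trans (inner-T w (inner-basic≡0 w {i} {i'} {j} {j'} (ℤₚ.+-comm (δ c j) (δ c j'))))
           (sym (colSum-inner U c))))
    where w = λ _ c′ → δ c c′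
  sumS-T : sumS T ≡ sumS U
  sumS-T = ℤₚ.+-injective (trans (sumS-inner T) (trans (inner-T χSℤ sumS≡0) (sym (sumS-inner U))))

0<m⇒0≤m-1 : ∀ {m} → 0 ℕ.< m → 0ℤ ≤ℤ + m - 1ℤ
0<m⇒0≤m-1 {suc m} _ = +≤+ z≤n

basic-nonneg : ∀ {n} (U : Table n) {i i' j j'} → i ≢ i' → j ≢ j' → 0 ℕ.< U i j' → 0 ℕ.< U i' j →
               ∀ r c → 0ℤ ≤ℤ + U r c + basicArray i i' j j' r c
basic-nonneg U {i} {i'} {j} {j'} i≢i' j≢j' 0<Uij' 0<Ui'j r c
  with i Finₚ.≟ r | i' Finₚ.≟ r | j Finₚ.≟ c | j' Finₚ.≟ c
... | yes refl | yes refl | _        | _        = contradiction refl i≢i'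
... | yes refl | no _     | yes refl | yes refl = contradiction refl j≢j'
... | yes refl | no _     | yes refl | no _     = +≤+ z≤n
... | yes refl | no _     | no _     | yes refl = 0<m⇒0≤m-1 0<Uij'
... | yes refl | no _     | no _     | no _     = +≤+ z≤n
... | no _     | yes refl | yes refl | yes refl = contradiction refl j≢j'
... | no _     | yes refl | yes refl | no _     = 0<m⇒0≤m-1 0<Ui'j
... | no _     | yes refl | no _     | yes refl = +≤+ z≤n
... | no _     | yes refl | no _     | no _     = +≤+ z≤n
... | no _     | no _     | _        | _        = +≤+ z≤n

∣i+1∣+1≡∣i∣ : ∀ {i} → i <ℤ 0ℤ → ∣ i + 1ℤ ∣ ℕ.+ 1 ≡ ∣ i ∣
∣i+1∣+1≡∣i∣ { -[1+ 0 ]}     _ = refl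
∣i+1∣+1≡∣i∣ { -[1+ suc m ]} _ = ℕₚ.+-comm (suc m) 1
∣i+1∣+1≡∣i∣ {+ _}           (+<+ ())

∣i-1∣+1≡∣i∣ : ∀ {i} → 0ℤ <ℤ i → ∣ i - 1ℤ ∣ ℕ.+ 1 ≡ ∣ i ∣
∣i-1∣+1≡∣i∣ {+ suc m}    _         = ℕₚ.+-comm m 1
∣i-1∣+1≡∣i∣ {+ 0}        (+<+ ())
∣i-1∣+1≡∣i∣ { -[1+ _ ]} ()

cell-shrinks : ∀ z {d} → ∣ z + d ∣ ℕ.+ 1 ≡ ∣ z ∣ → + ∣ z + d ∣ + 1ℤ ≤ℤ + ∣ z ∣ + 0ℤ
cell-shrinks z e = +≤+ (ℕₚ.≤-reflexive (trans e (sym (ℕₚ.+-identityʳ _))))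

cell-grows : ∀ z → + ∣ z + 1ℤ ∣ + 0ℤ ≤ℤ + ∣ z ∣ + 1ℤ
cell-grows z = +≤+ (ℕₚ.≤-trans (ℕₚ.≤-reflexive (ℕₚ.+-identityʳ _)) (ℤₚ.∣i+j∣≤∣i∣+∣j∣ z 1ℤ))

cell-fixed : ∀ z → + ∣ z + 0ℤ ∣ + 0ℤ ≤ℤ + ∣ z ∣ + 0ℤ
cell-fixed z rewrite ℤₚ.+-identityʳ z = ℤₚ.≤-refl

-- Pointwise: the three corners shrink by one, the fourth grows by at most one.
cell-bound : ∀ {n} (W : Array n) {i i' j j'} → i ≢ i' → j ≢ j' →
             W i j <ℤ 0ℤ → 0ℤ <ℤ W i j' → 0ℤ <ℤ W i' j → ∀ r c →
             + ∣ W r c + basicArray i i' j j' r c ∣ + ((unit i j r c + unit i j' r c) + unit i' j r c)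
               ≤ℤ + ∣ W r c ∣ + unit i' j' r c
cell-bound W {i} {i'} {j} {j'} i≢i' j≢j' Wij<0 0<Wij' 0<Wi'j r c
  with i Finₚ.≟ r | i' Finₚ.≟ r | j Finₚ.≟ c | j' Finₚ.≟ c
... | yes refl | yes refl | _        | _        = contradiction refl i≢i'
... | yes refl | no _     | yes refl | yes refl = contradiction refl j≢j'
... | yes refl | no _     | yes refl | no _     = cell-shrinks (W i j) (∣i+1∣+1≡∣i∣ Wij<0)
... | yes refl | no _     | no _     | yes refl = cell-shrinks (W i j') (∣i-1∣+1≡∣i∣ 0<Wij')
... | yes refl | no _     | no _     | no _     = cell-fixed (W i c)
... | no _     | yes refl | yes refl | yes refl = contradiction refl j≢j'
... | no _     | yes refl | yes refl | no _     = cell-shrinks (W i' j) (∣i-1∣+1≡∣i∣ 0<Wi'j)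
... | no _     | yes refl | no _     | yes refl = cell-grows (W i' j')
... | no _     | yes refl | no _     | no _     = cell-fixed (W i' c)
... | no _     | no _     | _        | _        = cell-fixed (W r c)

norm1-toℤ : ∀ {n} (W : Array n) → + norm1 W ≡ ∑∑ (λ r c → + ∣ W r c ∣)
norm1-toℤ W = trans (∑-toℤ (λ r → ∑ (λ c → ∣ W r c ∣))) (∑ℤ-cong (λ r → ∑-toℤ (λ c → ∣ W r c ∣)))

m+3≤n+1⇒m<n : ∀ {m n} → m ℕ.+ 3 ≤ n ℕ.+ 1 → m ℕ.< n
m+3≤n+1⇒m<n {m} {n} h rewrite ℕₚ.+-comm m 3 | ℕₚ.+-comm n 1 = ℕₚ.<⇒≤ (ℕ.s≤s⁻¹ h)

norm1-basic-< : ∀ {n} (W : Array n) {i i' j j'} → i ≢ i' → j ≢ j' →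
                W i j <ℤ 0ℤ → 0ℤ <ℤ W i j' → 0ℤ <ℤ W i' j →
                norm1 (W ⊕ basicArray i i' j j') ℕ.< norm1 W
norm1-basic-< {n} W {i} {i'} {j} {j'} i≢i' j≢j' Wij<0 0<Wij' 0<Wi'j = m+3≤n+1⇒m<n (ℤₚ.drop‿+≤+ (begin
  + norm1 W′ + ((1ℤ + 1ℤ) + 1ℤ)
    ≡⟨ cong₂ _+_ (norm1-toℤ W′) (sym ∑∑-shrinking) ⟩
  ∑∑ (λ r c → + ∣ W′ r c ∣) + ∑∑ shrinking
    ≡⟨ ∑∑-distrib-+ (λ r c → + ∣ W′ r c ∣) shrinking ⟨
  ∑∑ (λ r c → + ∣ W′ r c ∣ + shrinking r c)
    ≤⟨ ∑∑-mono-≤ (cell-bound W i≢i' j≢j' Wij<0 0<Wij' 0<Wi'j) ⟩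
  ∑∑ (λ r c → + ∣ W r c ∣ + unit i' j' r c)
    ≡⟨ ∑∑-distrib-+ (λ r c → + ∣ W r c ∣) (unit i' j') ⟩
  ∑∑ (λ r c → + ∣ W r c ∣) + ∑∑ (unit i' j')
    ≡⟨ cong₂ _+_ (sym (norm1-toℤ W)) (∑∑-unit i' j') ⟩
  + norm1 W + 1ℤ ∎))
  where
  open ℤₚ.≤-Reasoning
  W′ : Array n
  W′ = W ⊕ basicArray i i' j j'
  shrinking : Array n
  shrinking = (unit i j ⊕ unit i j') ⊕ unit i' j
  ∑∑-shrinking : ∑∑ shrinking ≡ (1ℤ + 1ℤ) + 1ℤ
  ∑∑-shrinking = trans (∑∑-distrib-+ (unit i j ⊕ unit i j') (unit i' j))
    (cong₂ _+_ (trans (∑∑-distrib-+ (unit i j) (unit i j')) (cong₂ _+_ (∑∑-unit i j) (∑∑-unit i j')))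
               (∑∑-unit i' j))

InS : ∀ {n} → Fin n → Fin (suc n) → Set
InS {n} r c = suc (suc (toℕ r ℕ.+ toℕ c)) ≤ suc n

χS-∈ : ∀ {n} {r : Fin n} {c} → InS r c → χS r c ≡ 1
χS-∈ {n} {r} {c} r,c∈S with suc (suc (toℕ r ℕ.+ toℕ c)) ℕ.≤? suc n
... | yes _     = refl
... | no  r,c∉S = contradiction r,c∈S r,c∉S

χS-∉ : ∀ {n} {r : Fin n} {c} → ¬ InS r c → χS r c ≡ 0
χS-∉ {n} {r} {c} r,c∉S with suc (suc (toℕ r ℕ.+ toℕ c)) ℕ.≤? suc n
... | yes r,c∈S = contradiction r,c∈S r,c∉S
... | no  _     = refl

InS-downward : ∀ {n} {r r′ : Fin n} {c} → toℕ r′ ℕ.≤ toℕ r → InS r c → InS r′ c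
InS-downward {c = c} r′≤r = ℕₚ.≤-trans (s≤s (s≤s (ℕₚ.+-monoˡ-≤ (toℕ c) r′≤r)))

χS-zero : ∀ {n} (r : Fin n) → χS r zero ≡ 1
χS-zero r = χS-∈ (s≤s (subst (ℕ._< _) (sym (ℕₚ.+-identityʳ (toℕ r))) (Finₚ.toℕ<n r)))

outer-row-with-same-χS : ∀ {n} {ia ib ic : Fin n} → ia < ib → ib < ic → ∀ c →
                         Σ[ k ∈ Fin n ] (k ≡ ia ⊎ k ≡ ic) × χS k c ≡ χS ib c
outer-row-with-same-χS {n} {ia} {ib} {ic} ia<ib ib<ic c with suc (suc (toℕ ib ℕ.+ toℕ c)) ℕ.≤? suc n
... | yes ib,c∈S = ia , inj₁ refl , χS-∈ (InS-downward (ℕₚ.<⇒≤ ia<ib) ib,c∈S)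
... | no  ib,c∉S = ic , inj₂ refl , χS-∉ (ib,c∉S ∘ InS-downward (ℕₚ.<⇒≤ ib<ic))

column-zero-balanced : ∀ {n} {i i' : Fin n} {c} → χS i' c ≡ χS i c →
                       χSℤ i zero + χSℤ i' c ≡ χSℤ i c + χSℤ i' zero
column-zero-balanced {i = i} {i'} {c} e rewrite χS-zero i | χS-zero i' | e = ℤₚ.+-comm 1ℤ (+ χS i c)

m<n⇒m-n<0 : ∀ {m n} → m ℕ.< n → + m - + n <ℤ 0ℤ
m<n⇒m-n<0 {m} {n} m<n =
  subst₂ _<ℤ_ (sym (ℤₚ.[+m]-[+n]≡m⊖n m n)) (ℤₚ.n⊖n≡0 n) (ℤₚ.⊖-monoˡ-< n m<n)

n<m⇒0<m-n : ∀ {m n} → n ℕ.< m → 0ℤ <ℤ + m - + n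
n<m⇒0<m-n {m} {n} n<m =
  subst₂ _<ℤ_ (ℤₚ.n⊖n≡0 n) (sym (ℤₚ.[+m]-[+n]≡m⊖n m n)) (ℤₚ.⊖-monoˡ-< n n<m)

m-n<0⇒m<n : ∀ {m n} → + m - + n <ℤ 0ℤ → m ℕ.< n
m-n<0⇒m<n {m} {n} m-n<0 = ℕₚ.≰⇒> λ n≤m → ℤₚ.<⇒≱ m-n<0
  (subst₂ _≤ℤ_ (ℤₚ.n⊖n≡0 n) (sym (ℤₚ.[+m]-[+n]≡m⊖n m n)) (ℤₚ.⊖-monoˡ-≤ n n≤m))

0<m-n⇒n<m : ∀ {m n} → 0ℤ <ℤ + m - + n → n ℕ.< m
0<m-n⇒n<m {m} {n} 0<m-n = ℕₚ.≰⇒> λ m≤n → ℤₚ.<⇒≱ 0<m-n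
  (subst₂ _≤ℤ_ (sym (ℤₚ.[+m]-[+n]≡m⊖n m n)) (ℤₚ.n⊖n≡0 n) (ℤₚ.⊖-monoˡ-≤ n m≤n))

InFiberOf-cong : ∀ {n} {X : Table n} {V W : Array n} → (∀ r c → V r c ≡ W r c) →
                 InFiberOf X V → InFiberOf X W
InFiberOf-cong V≗W (T , T≗V , T~X) = T , (λ r c → trans (T≗V r c) (V≗W r c)) , T~X

InFiberOf-transfer : ∀ {n} {X Y : Table n} {W : Array n} → SameFiber X Y → InFiberOf Y W → InFiberOf X W
InFiberOf-transfer (rowsXY , colsXY , sXY) (T , T≗W , (rowsTY , colsTY , sTY)) =
  T , T≗W , (λ r → trans (rowsTY r) (sym (rowsXY r))) , (λ c → trans (colsTY c) (sym (colsXY c))) ,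
  trans sTY (sym sXY)

norm1-cong : ∀ {n} (V W : Array n) → (∀ r c → ∣ V r c ∣ ≡ ∣ W r c ∣) → norm1 V ≡ norm1 W
norm1-cong V W V≈W = ∑-cong (λ r → ∑-cong (V≈W r))

ReducingMove : ∀ {n} → Table n → Table n → Set
ReducingMove {n} X Y =
  Σ[ B ∈ B₀S n ] (∀ r c → 0ℤ ≤ℤ + X r c + move B r c)
                 × norm1 ((toArray X ⊖ toArray Y) ⊕ move B) ℕ.< norm1 (toArray X ⊖ toArray Y)

reducible-by-move⁺ : ∀ {n} {X Y : Table n} → ReducingMove X Y → Reducible X Y
reducible-by-move⁺ {n} {X} {Y} (B , X+B≥0 , shorter) =
  B ∷ [] , [] , s≤s z≤n , fiber , (λ { (suc _) _ () }) ,
  subst (ℕ._< norm1 Z) (norm1-cong (Z ⊕ move B) ((Z ⊕ sumMoves (B ∷ [])) ⊕ sumMoves []) λ r c →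
    cong ∣_∣ (sym (trans (ℤₚ.+-identityʳ _) (cong (_+_ (Z r c)) (ℤₚ.+-identityʳ (move B r c))))))
    shorter
  where
  Z : Array n
  Z = toArray X ⊖ toArray Y
  fiber : ∀ k → 1 ≤ k → k ≤ 1 → InFiberOf X (toArray X ⊕ sumMoves (take k (B ∷ [])))
  fiber 1 _ _ = InFiberOf-cong (λ r c → cong (_+_ (+ X r c)) (sym (ℤₚ.+-identityʳ (move B r c))))
                               (move-fiber X B X+B≥0)
  fiber (suc (suc _)) _ (s≤s ())

reducible-by-move⁻ : ∀ {n} {X Y : Table n} → SameFiber X Y → ReducingMove Y X → Reducible X Y
reducible-by-move⁻ {n} {X} {Y} X~Y (B , Y+B≥0 , shorter) =
  [] , opposite B ∷ [] , s≤s z≤n , (λ { (suc _) _ () }) , fiber ,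
  subst₂ ℕ._<_
    (norm1-cong (Y′ ⊕ move B) ((Z ⊕ sumMoves []) ⊕ sumMoves (opposite B ∷ [])) same-cells)
    (norm1-cong Y′ Z (λ r c → ℤₚ.∣i-j∣≡∣j-i∣ (+ Y r c) (+ X r c)))
    shorter
  where
  Z Y′ : Array n
  Z  = toArray X ⊖ toArray Y
  Y′ = toArray Y ⊖ toArray X
  single-opposite : ∀ r c → sumMoves (opposite B ∷ []) r c ≡ - move B r c
  single-opposite r c = trans (ℤₚ.+-identityʳ _) (move-opposite B r c)
  fiber : ∀ k → 1 ≤ k → k ≤ 1 → InFiberOf X (toArray Y ⊖ sumMoves (take k (opposite B ∷ [])))
  fiber 1 _ _ = InFiberOf-cong (λ r c → cong (_+_ (+ Y r c))
                                 (sym (trans (cong -_ (single-opposite r c)) (ℤₚ.neg-involutive _))))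
                               (InFiberOf-transfer X~Y (move-fiber Y B Y+B≥0))
  fiber (suc (suc _)) _ (s≤s ())
  negate : ∀ x y b → - ((y - x) + b) ≡ (x - y) + - b
  negate = solve-∀
  same-cells : ∀ r c → ∣ Y′ r c + move B r c ∣ ≡ ∣ (Z r c + 0ℤ) + sumMoves (opposite B ∷ []) r c ∣
  same-cells r c = begin
    ∣ Y′ r c + move B r c ∣
      ≡⟨ ℤₚ.∣-i∣≡∣i∣ (Y′ r c + move B r c) ⟨
    ∣ - (Y′ r c + move B r c) ∣
      ≡⟨ cong ∣_∣ (negate (+ X r c) (+ Y r c) (move B r c)) ⟩
    ∣ Z r c + - move B r c ∣
      ≡⟨ cong ∣_∣ (cong₂ _+_ (ℤₚ.+-identityʳ (Z r c)) (single-opposite r c)) ⟨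
    ∣ (Z r c + 0ℤ) + sumMoves (opposite B ∷ []) r c ∣ ∎
    where open ≡-Reasoning

corners⇒ReducingMove : ∀ {n} {X Y : Table n} {i i' j j'} → i ≢ i' → j ≢ j' →
                       χSℤ i j + χSℤ i' j' ≡ χSℤ i j' + χSℤ i' j →
                       X i j ℕ.< Y i j → Y i j' ℕ.< X i j' → Y i' j ℕ.< X i' j → ReducingMove X Y
corners⇒ReducingMove {n} {X} {Y} {i} {i'} {j} {j'} i≢i' j≢j' balanced Xij<Yij Yij'<Xij' Yi'j<Xi'j =
  B , basic-nonneg X i≢i' j≢j' (ℕₚ.≤-<-trans z≤n Yij'<Xij') (ℕₚ.≤-<-trans z≤n Yi'j<Xi'j) ,
  norm1-basic-< (toArray X ⊖ toArray Y) i≢i' j≢j'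
                (m<n⇒m-n<0 Xij<Yij) (n<m⇒0<m-n Yij'<Xij') (n<m⇒0<m-n Yi'j<Xi'j)
  where
  B : B₀S n
  B = record { i = i ; i' = i' ; j = j ; j' = j' ; i≢i' = i≢i' ; j≢j' = j≢j'
             ; sumS≡0 = inner-basic≡0 χSℤ {i} {i'} {j} {j'} balanced }

three-rows⇒ReducingMove : ∀ {n} {X Y : Table n} {ia ib ic} → rowSum X ib ≡ rowSum Y ib →
                          ia < ib → ib < ic → X ib zero ℕ.< Y ib zero →
                          Y ia zero ℕ.< X ia zero → Y ic zero ℕ.< X ic zero → ReducingMove X Y
three-rows⇒ReducingMove {X = X} {Y} {ia} {ib} {ic} rowSums≡ ia<ib ib<ic Xib<Yib Yia<Xia Yic<Xic
  with ∑≡∑⇒∃> (X ib) (Y ib) rowSums≡ Xib<Yib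
... | c , Yibc<Xibc with outer-row-with-same-χS ia<ib ib<ic (Fin.suc c)
...   | _ , inj₁ refl , χS≡ = corners⇒ReducingMove {X = X} {Y} (Finₚ.<⇒≢ ia<ib ∘ sym) (λ ())
                                 (column-zero-balanced χS≡) Xib<Yib Yibc<Xibc Yia<Xia
...   | _ , inj₂ refl , χS≡ = corners⇒ReducingMove {X = X} {Y} (Finₚ.<⇒≢ ib<ic) (λ ())
                                 (column-zero-balanced χS≡) Xib<Yib Yibc<Xibc Yic<Xic

-- The hypotheses n ≥ 2 and X ≠ Y are implied by the sign pattern and not needed.
lemma5 : (n : ℕ) → 2 ≤ n → (X Y : Table n) →
    SameFiber X Y → ¬ (∀ r c → X r c ≡ Y r c) →
    (ia ib ic : Fin n) → ia < ib → ib < ic →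
    let Z = toArray X ⊖ toArray Y in
    ((+ 0 <ℤ Z ia zero) × (Z ib zero <ℤ + 0) × (+ 0 <ℤ Z ic zero))
    ⊎ ((Z ia zero <ℤ + 0) × (+ 0 <ℤ Z ib zero) × (Z ic zero <ℤ + 0)) →
    Reducible X Y
lemma5 n _ X Y X~Y _ ia ib ic ia<ib ib<ic (inj₁ (0<Zia , Zib<0 , 0<Zic)) =
  reducible-by-move⁺ (three-rows⇒ReducingMove {X = X} {Y} (proj₁ X~Y ib) ia<ib ib<ic
    (m-n<0⇒m<n Zib<0) (0<m-n⇒n<m 0<Zia) (0<m-n⇒n<m 0<Zic))
lemma5 n _ X Y X~Y _ ia ib ic ia<ib ib<ic (inj₂ (Zia<0 , 0<Zib , Zic<0)) =
  reducible-by-move⁻ X~Y (three-rows⇒ReducingMove {X = Y} {X} (sym (proj₁ X~Y ib)) ia<ib ib<ic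
    (0<m-n⇒n<m 0<Zib) (m-n<0⇒m<n Zia<0) (m-n<0⇒m<n Zic<0))
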